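{- Let $G=\langle N,E,L,\mathit{root}\rangle$ be an egraph, $r:N\to N$ a representative function for $G$, and $n,n_k\in N$. Then a call $\mathit{toexpr}(n_k,r)$ occurs in the execution trace of $\mathit{toexpr}(n,r)$ if and only if there is a (nonempty) path from $n$ to $n_k$ in $G_r$.
   Context: An egraph is a tuple $G=\langle N,E,L,\mathit{root}\rangle$ where $\langle N,E\rangle$ is a finite directed acyclic graph with ordered successors ($n[i]$ the $i$-th child of $n$, $\deg(n)$ its out-degree), $L$ maps nodes to function symbols or logical variables, and $\mathit{root}:N\to N$ induces the equivalence relation $\rho_{\mathit{root}}=\{(n,n')\mid\mathit{root}(n)=\mathit{root}(n')\}$, closed under congruence. A representative function is any $r:N\to N$. $G_r=\langle N,E_r\rangle$ with $E_r=\{(m,r(c))\mid m\in N,\ c\text{ a child of }m\}$. The recursive procedure $\mathit{toexpr}(m,r)$ returns $L(m)$ if $\deg(m)=0$, and otherwise calls $\mathit{toexpr}(r(m[i]),r)$ for each $i=1,\dots,\deg(m)$ and returns $L(m)$ applied to the results. The execution trace of an execution of $\mathit{toexpr}(n,r)$ is the (possibly infinite) sequence of recursive procedure calls made during that execution, not including the initial call itself.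
   Formalization: The execution trace of $\mathit{toexpr}(n,r)$ is the full call tree: it contains every call $\mathit{toexpr}(r(n[i]),r)$ for each i together with the traces of those calls, even when an earlier sibling call never terminates. The statement above fails without it. -}

module Defs where

open import Data.Nat using (ℕ)
open import Data.Fin using (Fin; toℕ)
open import Relation.Binary.PropositionalEquality using (_≡_)
open import Relation.Nullary using (¬_)

data Path⁺ {N : Set} (Edge : N → N → Set) : N → N → Set where
  [_]  : ∀ {a b} → Edge a b → Path⁺ Edge a b
  _∷_  : ∀ {a b c} → Edge a b → Path⁺ Edge b c → Path⁺ Edge a c

data ChildEdge {k : ℕ} (deg : Fin k → ℕ) (child : (n : Fin k) → Fin (deg n) → Fin k)
     : Fin k → Fin k → Set where
  edge : (m : Fin k) (i : Fin (deg m)) → ChildEdge deg child m (child m i)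

-- An egraph ⟨N, E, L, root⟩ with node set  Fin size , ordered successors
-- (child n i = n[i+1]), labels in  Λ  (function symbols / variables).
record Egraph (Λ : Set) : Set₁ where
  field
    size  : ℕ
    deg   : Fin size → ℕ
    child : (n : Fin size) → Fin (deg n) → Fin size
    L     : Fin size → Λ
    root  : Fin size → Fin size

    acyclic : ∀ n → ¬ Path⁺ (ChildEdge deg child) n n
    congruence : ∀ n n' → L n ≡ L n' → deg n ≡ deg n' →
      (∀ i j → toℕ i ≡ toℕ j → root (child n i) ≡ root (child n' j)) →
      root n ≡ root n'

module _ {Λ : Set} (G : Egraph Λ) where
  open Egraph G

  Node : Set
  Node = Fin size

  data E_ (r : Node → Node) : Node → Node → Set where
    edgeᵣ : (m : Node) (i : Fin (deg m)) → E_ r m (r (child m i))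

  -- InTrace r n m : a call toexpr(m, r) occurs in the execution trace of
  -- toexpr(n, r).  toexpr(n, r) calls toexpr(r(n[i]), r) for each child i,
  -- and the trace contains those calls together with their own traces.
  data InTrace (r : Node → Node) : Node → Node → Set where
    here  : ∀ n (i : Fin (deg n)) → InTrace r n (r (child n i))
    there : ∀ n (i : Fin (deg n)) {m} →
            InTrace r (r (child n i)) m → InTrace r n m

module Submission where

open import Defs
open import Data.Product using (_×_; _,_)

-- A call toexpr(r(n[i]), r) is exactly an edge n → r(n[i]) of G_r, and a nested
-- call is a further edge; so traces and nonempty G_r-paths are the same data.
module _ {Λ : Set} (G : Egraph Λ) (r : Node G → Node G) where

  InTrace⇒Path⁺ : ∀ {n m} → InTrace G r n m → Path⁺ (E_ G r) n m
  InTrace⇒Path⁺ (here n i)    = [ edgeᵣ n i ]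
  InTrace⇒Path⁺ (there n i t) = edgeᵣ n i ∷ InTrace⇒Path⁺ t

  Path⁺⇒InTrace : ∀ {n m} → Path⁺ (E_ G r) n m → InTrace G r n m
  Path⁺⇒InTrace [ edgeᵣ m i ]     = here m i
  Path⁺⇒InTrace (edgeᵣ m i ∷ p) = there m i (Path⁺⇒InTrace p)

lemma1 : {Λ : Set} (G : Egraph Λ) (r : Node G → Node G)
    (n nₖ : Node G) →
    (InTrace G r n nₖ → Path⁺ (E_ G r) n nₖ) × (Path⁺ (E_ G r) n nₖ → InTrace G r n nₖ)
lemma1 G r n nₖ = InTrace⇒Path⁺ G r , Path⁺⇒InTrace G r
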